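{- ${\bf ITL}^{\bf FS}$ is sound for the class of open dynamical systems.
   Context: Formulas of $\mathcal L$ are built from propositional variables and $\bot$ by $\wedge,\vee,\to,\circ,\Diamond,\Box$. ${\bf ITL}^0$ is axiomatized by all intuitionistic tautologies, $\neg\circ\bot$, $\circ(\varphi\wedge\psi)\leftrightarrow(\circ\varphi\wedge\circ\psi)$, $\circ(\varphi\vee\psi)\leftrightarrow(\circ\varphi\vee\circ\psi)$, $\circ(\varphi\to\psi)\to(\circ\varphi\to\circ\psi)$, $\Box(\varphi\to\psi)\to(\Box\varphi\to\Box\psi)$, $\Box(\varphi\to\psi)\to(\Diamond\varphi\to\Diamond\psi)$, $\Diamond(\varphi\vee\psi)\to(\Diamond\varphi\vee\Diamond\psi)$, $\Box\varphi\to\varphi\wedge\circ\Box\varphi$, $\varphi\vee\circ\Diamond\varphi\to\Diamond\varphi$, with rules: from $\varphi\to\circ\varphi$ infer $\varphi\to\Box\varphi$; from $\circ\varphi\to\varphi$ infer $\Diamond\varphi\to\varphi$; modus ponens; from $\varphi$ infer $\circ\varphi$. ${\bf ITL}^{\bf FS}={\bf ITL}^0+{\rm FS}_\circ+{\rm FS}_\Diamond$, where ${\rm FS}_\circ(\varphi,\psi)$ is $(\circ\varphi\to\circ\psi)\to\circ(\varphi\to\psi)$ and ${\rm FS}_\Diamond(\varphi,\psi)$ is $(\Diamond\varphi\to\Box\psi)\to\Box(\varphi\to\psi)$. A dynamical system $(X,\mathcal T,S)$ is a topological space with continuous $S\colon X\to X$; it is open if $S$ is moreover an open map (images of open sets are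 open). Valuations $[\![\cdot]\!]$ map formulas to open sets: $[\![\bot]\!]=\varnothing$, $\cap$ for $\wedge$, $\cup$ for $\vee$, $[\![\varphi\to\psi]\!]=((X\setminus[\![\varphi]\!])\cup[\![\psi]\!])^\circ$, $[\![\circ\varphi]\!]=S^{ -1}[\![\varphi]\!]$, $[\![\Diamond\varphi]\!]=\bigcup_{n\ge0}S^{ -n}[\![\varphi]\!]$, $[\![\Box\varphi]\!]=\bigcup\{U\in\mathcal T:S[U]\subseteq U\subseteq[\![\varphi]\!]\}$. Soundness for a class means every derivable formula has $[\![\varphi]\!]=X$ for every valuation on every system in the class. -}

module Defs where

open import Data.Nat using (ℕ; zero; suc)
open import Data.Product using (Σ; _×_)
open import Data.Unit using (⊤)
open import Data.Empty using (⊥)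
open import Data.Sum using (_⊎_)
open import Relation.Binary.PropositionalEquality using (_≡_)

infixr 4 _⇒_
infixr 5 _∨'_
infixr 6 _∧'_

data Fm : Set where
  var  : ℕ → Fm
  ⊥'   : Fm
  _∧'_ : Fm → Fm → Fm
  _∨'_ : Fm → Fm → Fm
  _⇒_  : Fm → Fm → Fm
  ○    : Fm → Fm
  ◇    : Fm → Fm
  □    : Fm → Fm

¬' : Fm → Fm
¬' φ = φ ⇒ ⊥'

_⇔_ : Fm → Fm → Fm
φ ⇔ ψ = (φ ⇒ ψ) ∧' (ψ ⇒ φ)

-- The logic ITL^FS = ITL^0 + FS_○ + FS_◇.
-- "All intuitionistic tautologies" (substitution instances in L of
-- theorems of IPC) are generated by the standard Hilbert axiom schemes of
-- IPC together with modus ponens (which is a rule of the system anyway).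

data ITLFS : Fm → Set where
  ipc-K    : ∀ φ ψ → ITLFS (φ ⇒ ψ ⇒ φ)
  ipc-S    : ∀ φ ψ χ → ITLFS ((φ ⇒ ψ ⇒ χ) ⇒ (φ ⇒ ψ) ⇒ φ ⇒ χ)
  ipc-∧i   : ∀ φ ψ → ITLFS (φ ⇒ ψ ⇒ φ ∧' ψ)
  ipc-∧e₁  : ∀ φ ψ → ITLFS (φ ∧' ψ ⇒ φ)
  ipc-∧e₂  : ∀ φ ψ → ITLFS (φ ∧' ψ ⇒ ψ)
  ipc-∨i₁  : ∀ φ ψ → ITLFS (φ ⇒ φ ∨' ψ)
  ipc-∨i₂  : ∀ φ ψ → ITLFS (ψ ⇒ φ ∨' ψ)
  ipc-∨e   : ∀ φ ψ χ → ITLFS ((φ ⇒ χ) ⇒ (ψ ⇒ χ) ⇒ φ ∨' ψ ⇒ χ)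
  ipc-efq  : ∀ φ → ITLFS (⊥' ⇒ φ)
  ax-○⊥    : ITLFS (¬' (○ ⊥'))
  ax-○∧    : ∀ φ ψ → ITLFS (○ (φ ∧' ψ) ⇔ (○ φ ∧' ○ ψ))
  ax-○∨    : ∀ φ ψ → ITLFS (○ (φ ∨' ψ) ⇔ (○ φ ∨' ○ ψ))
  ax-K○    : ∀ φ ψ → ITLFS (○ (φ ⇒ ψ) ⇒ (○ φ ⇒ ○ ψ))
  ax-K□    : ∀ φ ψ → ITLFS (□ (φ ⇒ ψ) ⇒ (□ φ ⇒ □ ψ))
  ax-K◇    : ∀ φ ψ → ITLFS (□ (φ ⇒ ψ) ⇒ (◇ φ ⇒ ◇ ψ))
  ax-◇∨    : ∀ φ ψ → ITLFS (◇ (φ ∨' ψ) ⇒ (◇ φ ∨' ◇ ψ))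
  ax-□fix  : ∀ φ → ITLFS (□ φ ⇒ φ ∧' ○ (□ φ))
  ax-◇fix  : ∀ φ → ITLFS (φ ∨' ○ (◇ φ) ⇒ ◇ φ)
  ax-FS○   : ∀ φ ψ → ITLFS ((○ φ ⇒ ○ ψ) ⇒ ○ (φ ⇒ ψ))
  ax-FS◇   : ∀ φ ψ → ITLFS ((◇ φ ⇒ □ ψ) ⇒ □ (φ ⇒ ψ))
  r-□ind   : ∀ φ → ITLFS (φ ⇒ ○ φ) → ITLFS (φ ⇒ □ φ)
  r-◇ind   : ∀ φ → ITLFS (○ φ ⇒ φ) → ITLFS (◇ φ ⇒ φ)
  r-mp     : ∀ φ ψ → ITLFS (φ ⇒ ψ) → ITLFS φ → ITLFS ψ
  r-nec    : ∀ φ → ITLFS φ → ITLFS (○ φ)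

-- The opens are given as a family indexed by a small
-- type Opn (to avoid quantifying over all predicates, which would raise the
-- universe level); a predicate is open iff it is extensionally equal to
-- some member of the family.

record TopSpace : Set₁ where
  field
    Pt  : Set
    Opn : Set
    ⟪_⟫ : Opn → Pt → Set

  IsOpen : (Pt → Set) → Set
  IsOpen P = Σ Opn λ o → ∀ x → (⟪ o ⟫ x → P x) × (P x → ⟪ o ⟫ x)

  field
    open-whole : IsOpen (λ _ → ⊤)
    open-∩     : ∀ o o' → IsOpen (λ x → ⟪ o ⟫ x × ⟪ o' ⟫ x)
    open-⋃     : (I : Set) (f : I → Opn) → IsOpen (λ x → Σ I λ i → ⟪ f i ⟫ x)

iter : {A : Set} → (A → A) → ℕ → A → A
iter f zero    x = x
iter f (suc n) x = f (iter f n x)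

record OpenDynSys : Set₁ where
  field
    space : TopSpace
  open TopSpace space public
  field
    S          : Pt → Pt
    continuous : ∀ o → IsOpen (λ x → ⟪ o ⟫ (S x))
    open-map   : ∀ o → IsOpen (λ y → Σ Pt λ x → ⟪ o ⟫ x × S x ≡ y)

module _ (D : OpenDynSys) where
  open OpenDynSys D

  ⟦_⟧ : Fm → (ℕ → Opn) → Pt → Set
  ⟦ var n ⟧  V x = ⟪ V n ⟫ x
  ⟦ ⊥' ⟧     V x = ⊥
  ⟦ φ ∧' ψ ⟧ V x = ⟦ φ ⟧ V x × ⟦ ψ ⟧ V x
  ⟦ φ ∨' ψ ⟧ V x = ⟦ φ ⟧ V x ⊎ ⟦ ψ ⟧ V x
  ⟦ φ ⇒ ψ ⟧  V x = Σ Opn λ o → ⟪ o ⟫ x × (∀ y → ⟪ o ⟫ y → ⟦ φ ⟧ V y → ⟦ ψ ⟧ V y)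
  ⟦ ○ φ ⟧    V x = ⟦ φ ⟧ V (S x)
  ⟦ ◇ φ ⟧    V x = Σ ℕ λ n → ⟦ φ ⟧ V (iter S n x)
  ⟦ □ φ ⟧    V x = Σ Opn λ o → ⟪ o ⟫ x × (∀ y → ⟪ o ⟫ y → ⟪ o ⟫ (S y))
                                       × (∀ y → ⟪ o ⟫ y → ⟦ φ ⟧ V y)

ValidOpen : Fm → Set₁
ValidOpen φ = (D : OpenDynSys) (V : ℕ → OpenDynSys.Opn D) (x : OpenDynSys.Pt D) → ⟦ D ⟧ φ V x

module Submission where

-- Every truth set
-- ⟦ φ ⟧ is open, so by the clause for implication, φ ⇒ ψ is valid exactly
-- when ⟦ φ ⟧ ⊆ ⟦ ψ ⟧ (the whole space is an admissible neighbourhood).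
-- Soundness is therefore proved by showing that every axiom is such an
-- inclusion of truth sets and that every rule preserves validity.
--
-- Then come the semantic lemmas, one per axiom or rule;
-- openness of S is used only for the Fischer Servi axioms: FS○ pushes a
-- neighbourhood forward along S, FS◇ along the whole forward orbit.

open import Defs
open import Level using (0ℓ)
open import Function using (id)
open import Data.Nat using (ℕ; zero; suc)
open import Data.Product using (Σ; _×_; _,_; proj₁; proj₂)
open import Data.Unit using (tt)
open import Data.Empty using (⊥; ⊥-elim)
open import Data.Sum using (inj₁; inj₂)
open import Data.Bool using (Bool; true; false)
open import Relation.Unary using (Pred; _⊆′_; ∅; _∩_; _∪_; ⋃)
open import Relation.Binary.PropositionalEquality using (_≡_; refl; cong; subst)

iter-shift : {A : Set} (f : A → A) (n : ℕ) (x : A) → iter f n (f x) ≡ f (iter f n x)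
iter-shift f zero    x = refl
iter-shift f (suc n) x = cong f (iter-shift f n x)

module OpenSets (X : TopSpace) where
  open TopSpace X

  code : {P : Pred Pt 0ℓ} → IsOpen P → Opn
  code = proj₁

  decode : {P : Pred Pt 0ℓ} (p : IsOpen P) → ⟪ code p ⟫ ⊆′ P
  decode p x = proj₁ (proj₂ p x)

  encode : {P : Pred Pt 0ℓ} (p : IsOpen P) → P ⊆′ ⟪ code p ⟫
  encode p x = proj₂ (proj₂ p x)

  basic-open : (o : Opn) → IsOpen ⟪ o ⟫
  basic-open o = o , λ _ → id , id

  open-resp : {P Q : Pred Pt 0ℓ} → P ⊆′ Q → Q ⊆′ P → IsOpen P → IsOpen Q
  open-resp P⊆Q Q⊆P p =
    code p , λ x → (λ px → P⊆Q x (decode p x px)) , (λ qx → encode p x (Q⊆P x qx))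

  ⋃-open : (I : Set) (P : I → Pred Pt 0ℓ) → (∀ i → IsOpen (P i)) → IsOpen (⋃ I P)
  ⋃-open I P P-open =
    open-resp (λ x (i , h) → i , decode (P-open i) x h)
              (λ x (i , h) → i , encode (P-open i) x h)
              (open-⋃ I (λ i → code (P-open i)))

  ∅-open : IsOpen ∅
  ∅-open = open-resp (λ _ (i , _) → i) (λ _ ()) (open-⋃ ⊥ ⊥-elim)

  ∪-open : {P Q : Pred Pt 0ℓ} → IsOpen P → IsOpen Q → IsOpen (P ∪ Q)
  ∪-open {P} {Q} p q =
    open-resp (λ { _ (true , h) → inj₁ h ; _ (false , h) → inj₂ h })
              (λ { _ (inj₁ h) → true , h ; _ (inj₂ h) → false , h })
              (⋃-open Bool either λ { true → p ; false → q })
    where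
      either : Bool → Pred Pt 0ℓ
      either true  = P
      either false = Q

  ∩-open : {P Q : Pred Pt 0ℓ} → IsOpen P → IsOpen Q → IsOpen (P ∩ Q)
  ∩-open p q =
    open-resp (λ x (a , b) → decode p x a , decode q x b)
              (λ x (a , b) → encode p x a , encode q x b)
              (open-∩ (code p) (code q))

  -- The union of all basic opens having a property R is open; this is the
  -- shape of the clauses for ⇒ and □.
  nbhd-open : (R : Opn → Set) → IsOpen (λ x → Σ Opn λ o → ⟪ o ⟫ x × R o)
  nbhd-open R =
    open-resp (λ x ((o , r) , xo) → o , xo , r)
              (λ x (o , xo , r) → (o , r) , xo)
              (open-⋃ (Σ Opn R) proj₁)

module Dynamics (D : OpenDynSys) where
  open OpenDynSys D
  open OpenSets space

  preimage-open : {P : Pred Pt 0ℓ} → IsOpen P → IsOpen (λ x → P (S x))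
  preimage-open p =
    open-resp (λ x → decode p (S x)) (λ x → encode p (S x)) (continuous (code p))

  iter-preimage-open : {P : Pred Pt 0ℓ} (n : ℕ) → IsOpen P → IsOpen (λ x → P (iter S n x))
  iter-preimage-open zero    p = p
  iter-preimage-open (suc n) p = iter-preimage-open n (preimage-open p)

  Image : Pred Pt 0ℓ → Pred Pt 0ℓ
  Image P y = Σ Pt λ x → P x × S x ≡ y

  image-open : {P : Pred Pt 0ℓ} → IsOpen P → IsOpen (Image P)
  image-open p =
    open-resp (λ _ (x , xo , e) → x , decode p x xo , e)
              (λ _ (x , px , e) → x , encode p x px , e)
              (open-map (code p))

  Image^ : ℕ → Pred Pt 0ℓ → Pred Pt 0ℓ
  Image^ zero    P = P
  Image^ (suc n) P = Image (Image^ n P)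

  image^-open : {P : Pred Pt 0ℓ} (n : ℕ) → IsOpen P → IsOpen (Image^ n P)
  image^-open zero    p = p
  image^-open (suc n) p = image-open (image^-open n p)

  image^-origin : {P : Pred Pt 0ℓ} (n : ℕ) (y : Pt) → Image^ n P y → Σ Pt λ x → P x × iter S n x ≡ y
  image^-origin zero    y py          = y , py , refl
  image^-origin (suc n) y (z , h , e) with image^-origin n z h
  ... | x , px , refl = x , px , e

  Invariant : Pred Pt 0ℓ → Set
  Invariant P = ∀ y → P y → P (S y)

  invariant-iter : {P : Pred Pt 0ℓ} → Invariant P → ∀ n y → P y → P (iter S n y)
  invariant-iter inv zero    y py = py
  invariant-iter inv (suc n) y py = inv _ (invariant-iter inv n y py)

  Orbit : Pred Pt 0ℓ → Pred Pt 0ℓ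
  Orbit P = ⋃ ℕ λ n → Image^ n P

  orbit-open : {P : Pred Pt 0ℓ} → IsOpen P → IsOpen (Orbit P)
  orbit-open p = ⋃-open ℕ _ λ n → image^-open n p

  orbit-invariant : {P : Pred Pt 0ℓ} → Invariant (Orbit P)
  orbit-invariant y (n , h) = suc n , y , h , refl

module Soundness (D : OpenDynSys) (V : ℕ → OpenDynSys.Opn D) where
  open OpenDynSys D
  open OpenSets space
  open Dynamics D

  T : Fm → Pred Pt 0ℓ
  T φ = ⟦ D ⟧ φ V

  ⟦⟧-open : (φ : Fm) → IsOpen (T φ)
  ⟦⟧-open (var n)  = basic-open (V n)
  ⟦⟧-open ⊥'       = ∅-open
  ⟦⟧-open (φ ∧' ψ) = ∩-open (⟦⟧-open φ) (⟦⟧-open ψ)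
  ⟦⟧-open (φ ∨' ψ) = ∪-open (⟦⟧-open φ) (⟦⟧-open ψ)
  ⟦⟧-open (φ ⇒ ψ)  = nbhd-open _
  ⟦⟧-open (○ φ)    = preimage-open (⟦⟧-open φ)
  ⟦⟧-open (◇ φ)    = ⋃-open ℕ _ λ n → iter-preimage-open n (⟦⟧-open φ)
  ⟦⟧-open (□ φ)    = nbhd-open _

  Valid : Fm → Set
  Valid φ = ∀ x → T φ x

  -- Semantic entailment in the model.  Being a record, it lets Agda read
  -- off the two formulas, which it cannot do from their truth sets.
  infix 2 _⊨_
  record _⊨_ (φ ψ : Fm) : Set where
    constructor entails
    field at : T φ ⊆′ T ψ
  open _⊨_

  valid-⇒ : {φ ψ : Fm} → φ ⊨ ψ → Valid (φ ⇒ ψ)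
  valid-⇒ φ⊨ψ x = code open-whole , encode open-whole x tt , λ y _ → at φ⊨ψ y

  valid-⇔ : {φ ψ : Fm} → φ ⊨ ψ → ψ ⊨ φ → Valid (φ ⇔ ψ)
  valid-⇔ φ⊨ψ ψ⊨φ x = valid-⇒ φ⊨ψ x , valid-⇒ ψ⊨φ x

  -- Intuitionistic axioms.  K and ∧-introduction rely on truth sets being
  -- open; S and ∨-elimination intersect two neighbourhoods.
  weakening : ∀ φ ψ → φ ⊨ ψ ⇒ φ
  weakening φ ψ = entails λ x φx → code p , encode p x φx , λ y yp _ → decode p y yp
    where p = ⟦⟧-open φ

  ⇒-distrib : ∀ φ ψ χ → φ ⇒ ψ ⇒ χ ⊨ (φ ⇒ ψ) ⇒ φ ⇒ χ
  ⇒-distrib φ ψ χ = entails λ x (a , xa , f) → a , xa , λ y ya (b , yb , g) →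
    let ab = open-∩ a b in
    code ab , encode ab y (ya , yb) , λ z zab φz →
      let (za , zb) = decode ab z zab
          (_ , zc , h) = f z za φz
      in h z zc (g z zb φz)

  ∧-intro : ∀ φ ψ → φ ⊨ ψ ⇒ φ ∧' ψ
  ∧-intro φ ψ = entails λ x φx → code p , encode p x φx , λ y yp ψy → decode p y yp , ψy
    where p = ⟦⟧-open φ

  ∨-elim : ∀ φ ψ χ → φ ⇒ χ ⊨ (ψ ⇒ χ) ⇒ φ ∨' ψ ⇒ χ
  ∨-elim φ ψ χ = entails λ x (a , xa , f) → a , xa , λ y ya (b , yb , g) →
    let ab = open-∩ a b in
    code ab , encode ab y (ya , yb) , λ where
      z zab (inj₁ φz) → f z (proj₁ (decode ab z zab)) φz
      z zab (inj₂ ψz) → g z (proj₂ (decode ab z zab)) ψz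

  ∧-elim₁ : ∀ φ ψ → φ ∧' ψ ⊨ φ
  ∧-elim₁ φ ψ = entails λ _ → proj₁

  ∧-elim₂ : ∀ φ ψ → φ ∧' ψ ⊨ ψ
  ∧-elim₂ φ ψ = entails λ _ → proj₂

  ∨-intro₁ : ∀ φ ψ → φ ⊨ φ ∨' ψ
  ∨-intro₁ φ ψ = entails λ _ → inj₁

  ∨-intro₂ : ∀ φ ψ → ψ ⊨ φ ∨' ψ
  ∨-intro₂ φ ψ = entails λ _ → inj₂

  ex-falso : ∀ φ → ⊥' ⊨ φ
  ex-falso φ = entails λ _ ()

  ○-⊥ : ○ ⊥' ⊨ ⊥'
  ○-⊥ = entails λ _ ()

  ○-∧ : ∀ φ ψ → ○ (φ ∧' ψ) ⊨ ○ φ ∧' ○ ψ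
  ○-∧ φ ψ = entails λ _ → id

  ○-∧⁻¹ : ∀ φ ψ → ○ φ ∧' ○ ψ ⊨ ○ (φ ∧' ψ)
  ○-∧⁻¹ φ ψ = entails λ _ → id

  ○-∨ : ∀ φ ψ → ○ (φ ∨' ψ) ⊨ ○ φ ∨' ○ ψ
  ○-∨ φ ψ = entails λ _ → id

  ○-∨⁻¹ : ∀ φ ψ → ○ φ ∨' ○ ψ ⊨ ○ (φ ∨' ψ)
  ○-∨⁻¹ φ ψ = entails λ _ → id

  ◇-∨ : ∀ φ ψ → ◇ (φ ∨' ψ) ⊨ ◇ φ ∨' ◇ ψ
  ◇-∨ φ ψ = entails λ where
    _ (n , inj₁ φn) → inj₁ (n , φn)
    _ (n , inj₂ ψn) → inj₂ (n , ψn)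

  -- K for ○: pull the neighbourhood of S x back along the continuous S.
  ○-distrib : ∀ φ ψ → ○ (φ ⇒ ψ) ⊨ ○ φ ⇒ ○ ψ
  ○-distrib φ ψ = entails λ x (o , Sxo , f) →
    let p = continuous o in
    code p , encode p x Sxo , λ y yp φSy → f (S y) (decode p y yp) φSy

  -- Fischer Servi for ○: push the neighbourhood of x forward along the open
  -- map S; it is then a neighbourhood of S x on which φ ⇒ ψ holds.
  ○-FS : ∀ φ ψ → ○ φ ⇒ ○ ψ ⊨ ○ (φ ⇒ ψ)
  ○-FS φ ψ = entails λ x (o , xo , f) →
    let p = image-open (basic-open o)
        pushed : ∀ y → Image ⟪ o ⟫ y → T φ y → T ψ y
        pushed = λ { _ (z , zo , refl) φSz → f z zo φSz }
    in code p , encode p (S x) (x , xo , refl) , λ y yp → pushed y (decode p y yp)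

  -- K for □: the intersection of two invariant neighbourhoods is one.
  □-distrib : ∀ φ ψ → □ (φ ⇒ ψ) ⊨ □ φ ⇒ □ ψ
  □-distrib φ ψ = entails λ x (a , xa , a-inv , f) → a , xa , λ y ya (b , yb , b-inv , g) →
    let ab = open-∩ a b in
    code ab , encode ab y (ya , yb)
      , (λ z zab → let (za , zb) = decode ab z zab in encode ab (S z) (a-inv z za , b-inv z zb))
      , (λ z zab → let (za , zb) = decode ab z zab
                       (_ , zc , h) = f z za
                   in h z zc (g z zb))

  -- K for ◇: the invariant neighbourhood contains the whole forward orbit.
  ◇-distrib : ∀ φ ψ → □ (φ ⇒ ψ) ⊨ ◇ φ ⇒ ◇ ψ
  ◇-distrib φ ψ = entails λ x (o , xo , o-inv , f) → o , xo , λ y yo (n , φn) →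
    let (_ , nc , h) = f (iter S n y) (invariant-iter o-inv n y yo)
    in n , h (iter S n y) nc φn

  □-unfold : ∀ φ → □ φ ⊨ φ ∧' ○ (□ φ)
  □-unfold φ = entails λ x (o , xo , o-inv , f) → f x xo , (o , o-inv x xo , o-inv , f)

  ◇-fold : ∀ φ → φ ∨' ○ (◇ φ) ⊨ ◇ φ
  ◇-fold φ = entails λ where
    x (inj₁ φx)       → zero , φx
    x (inj₂ (n , φn)) → suc n , subst (T φ) (iter-shift S n x) φn

  -- If ◇φ ⇒ □ψ holds on a neighbourhood U of x, then
  -- φ ⇒ ψ holds throughout the forward orbit of U, which is an open
  -- invariant neighbourhood of x: a point Sⁿ u satisfying φ makes ◇φ true at
  -- u, hence u has an invariant neighbourhood where ψ holds, containing Sⁿ u.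
  ◇-FS : ∀ φ ψ → ◇ φ ⇒ □ ψ ⊨ □ (φ ⇒ ψ)
  ◇-FS φ ψ = entails λ x (o , xo , f) →
    let orb = orbit-open (basic-open o)
        on-orbit : ∀ y → Orbit ⟪ o ⟫ y → T (φ ⇒ ψ) y
        on-orbit = λ y (n , yn) →
          let pn = image^-open n (basic-open o)
              from-origin : ∀ w → (Σ Pt λ u → ⟪ o ⟫ u × iter S n u ≡ w) → T φ w → T ψ w
              from-origin = λ { _ (u , uo , refl) φw →
                let (c , uc , c-inv , g) = f u uo (n , φw)
                in g _ (invariant-iter c-inv n u uc) }
          in code pn , encode pn y yn , λ w wn → from-origin w (image^-origin n w (decode pn w wn))
    in code orb , encode orb x (zero , xo)
       , (λ y y∈ → encode orb (S y) (orbit-invariant y (decode orb y y∈)))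
       , (λ y y∈ → on-orbit y (decode orb y y∈))

  -- Rules.  □-induction: the open set ⟦ φ ⟧ is itself invariant.
  □-induction : ∀ φ → Valid (φ ⇒ ○ φ) → φ ⊨ □ φ
  □-induction φ step = entails λ x φx →
    code p , encode p x φx , (λ y yp → encode p (S y) (forward y (decode p y yp))) , decode p
    where
      p = ⟦⟧-open φ
      forward : ∀ y → T φ y → T (○ φ) y
      forward y φy = let (_ , yo , f) = step y in f y yo φy

  ◇-induction : ∀ φ → Valid (○ φ ⇒ φ) → ◇ φ ⊨ φ
  ◇-induction φ step = entails λ x (n , φn) → backward x n φn
    where
      backward : ∀ x n → T φ (iter S n x) → T φ x
      backward x zero    φx = φx
      backward x (suc n) φn = let (_ , yo , f) = step (iter S n x) in backward x n (f _ yo φn)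

  modus-ponens : ∀ φ ψ → Valid (φ ⇒ ψ) → Valid φ → Valid ψ
  modus-ponens φ ψ φ⇒ψ φ-valid x = let (_ , xo , f) = φ⇒ψ x in f x xo (φ-valid x)

  necessitation : ∀ φ → Valid φ → Valid (○ φ)
  necessitation φ φ-valid x = φ-valid (S x)

  sound : {φ : Fm} → ITLFS φ → Valid φ
  sound (ipc-K φ ψ)       = valid-⇒ (weakening φ ψ)
  sound (ipc-S φ ψ χ)     = valid-⇒ (⇒-distrib φ ψ χ)
  sound (ipc-∧i φ ψ)      = valid-⇒ (∧-intro φ ψ)
  sound (ipc-∧e₁ φ ψ)     = valid-⇒ (∧-elim₁ φ ψ)
  sound (ipc-∧e₂ φ ψ)     = valid-⇒ (∧-elim₂ φ ψ)
  sound (ipc-∨i₁ φ ψ)     = valid-⇒ (∨-intro₁ φ ψ)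
  sound (ipc-∨i₂ φ ψ)     = valid-⇒ (∨-intro₂ φ ψ)
  sound (ipc-∨e φ ψ χ)    = valid-⇒ (∨-elim φ ψ χ)
  sound (ipc-efq φ)       = valid-⇒ (ex-falso φ)
  sound ax-○⊥             = valid-⇒ ○-⊥
  sound (ax-○∧ φ ψ)       = valid-⇔ (○-∧ φ ψ) (○-∧⁻¹ φ ψ)
  sound (ax-○∨ φ ψ)       = valid-⇔ (○-∨ φ ψ) (○-∨⁻¹ φ ψ)
  sound (ax-K○ φ ψ)       = valid-⇒ (○-distrib φ ψ)
  sound (ax-K□ φ ψ)       = valid-⇒ (□-distrib φ ψ)
  sound (ax-K◇ φ ψ)       = valid-⇒ (◇-distrib φ ψ)
  sound (ax-◇∨ φ ψ)       = valid-⇒ (◇-∨ φ ψ)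
  sound (ax-□fix φ)       = valid-⇒ (□-unfold φ)
  sound (ax-◇fix φ)       = valid-⇒ (◇-fold φ)
  sound (ax-FS○ φ ψ)      = valid-⇒ (○-FS φ ψ)
  sound (ax-FS◇ φ ψ)      = valid-⇒ (◇-FS φ ψ)
  sound (r-□ind φ d)      = valid-⇒ (□-induction φ (sound d))
  sound (r-◇ind φ d)      = valid-⇒ (◇-induction φ (sound d))
  sound (r-mp φ ψ d e)    = modus-ponens φ ψ (sound d) (sound e)
  sound (r-nec φ d)       = necessitation φ (sound d)

theorem5p4 : (φ : Fm) → ITLFS φ → ValidOpen φ
theorem5p4 φ d D V = Soundness.sound D V d
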